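{- Let $c$ be a positive integer and $n\ge 0$. Then $$f(n)=\begin{cases} n!, & \text{if } n<c+1,\\ \sum_{j=1}^{n} f(j-1)\cdot g(1,n-j+1)\cdot\binom{n-1}{j-1}, & \text{if } n\ge c+1.\end{cases}$$
   Context: Permutations are written in one-line notation. The equivalence on $S_n$ is the equivalence relation generated by declaring $\phi\equiv\psi$ whenever $\phi=aub$, $\psi=avb$ for words $a,b$ and contiguous factors $u,v$ of length $c+1$ whose order permutations (the permutations of $\{1,\ldots,c+1\}$ with the same relative order) both begin with $1$. $f(n)$ is the number of equivalence classes of $S_n$ (with $f(0)=1$). A permutation in $S_n$ is $1$-squished if its first letter is $1$, and $g(1,n)$ denotes the number of equivalence classes of $S_n$ containing at least one $1$-squished permutation. -}

module Defs where

open import Data.Nat using (ℕ; zero; suc; _<?_)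
open import Data.List using (List; []; _∷_; _++_; length; map; filter; upTo; head)
open import Data.Maybe using (just)
open import Data.Product using (Σ; ∃; _×_; _,_)
open import Data.List.Relation.Binary.Permutation.Propositional using (_↭_)
open import Data.List.Relation.Unary.All using (All)
open import Data.List.Relation.Unary.Any using (Any)
open import Data.List.Relation.Unary.AllPairs using (AllPairs)
open import Relation.Binary.PropositionalEquality using (_≡_)
open import Relation.Binary.Construct.Closure.Equivalence using (EqClosure)
open import Relation.Nullary using (¬_)
open import Data.Unit using (⊤)

-- A word (one-line notation) is a list of natural numbers.
Word : Set
Word = List ℕ

IsPerm : ℕ → Word → Set
IsPerm n φ = φ ↭ map suc (upTo n)

orderPerm : Word → Word
orderPerm u = map (λ x → suc (length (filter (_<? x) u))) u

BeginsWith1 : Word → Set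
BeginsWith1 u = head (orderPerm u) ≡ just 1

Move : ℕ → Word → Word → Set
Move c φ ψ = Σ Word λ a → Σ Word λ b → Σ Word λ u → Σ Word λ v →
  (φ ≡ a ++ (u ++ b)) × (ψ ≡ a ++ (v ++ b)) ×
  (length u ≡ suc c) × (length v ≡ suc c) ×
  BeginsWith1 u × BeginsWith1 v

MoveIn : ℕ → ℕ → Word → Word → Set
MoveIn c n φ ψ = IsPerm n φ × IsPerm n ψ × Move c φ ψ

Equiv : ℕ → ℕ → Word → Word → Set
Equiv c n = EqClosure (MoveIn c n)

-- The number of equivalence classes of those permutations φ ∈ S_n with P φ
-- is k: there is a list of k pairwise inequivalent representatives
-- (each in S_n satisfying P) such that every φ ∈ S_n with P φ is
-- equivalent to one of them.
ClassesMeeting : ℕ → ℕ → (Word → Set) → ℕ → Set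
ClassesMeeting c n P k = Σ (List Word) λ reps →
  (length reps ≡ k) ×
  All (λ r → IsPerm n r × P r) reps ×
  AllPairs (λ r s → ¬ Equiv c n r s) reps ×
  (∀ φ → IsPerm n φ → P φ → Any (Equiv c n φ) reps)

AnyWord : Word → Set
AnyWord _ = ⊤

Squished1 : Word → Set
Squished1 φ = head φ ≡ just 1

IsF : ℕ → ℕ → ℕ → Set
IsF c n k = ClassesMeeting c n AnyWord k

-- g(1,n) = k : exactly k classes of S_n contain a 1-squished permutation.
IsG1 : ℕ → ℕ → ℕ → Set
IsG1 c n k = ClassesMeeting c n Squished1 k

-- Write a permutation of S_n (n ≥ 1) as α 1 β.  A factor whose order permutation begins with 1
-- starts with its minimum, so a factor containing the letter 1 must start with it, and then its
-- replacement starts with 1 as well.  Hence no move carries a letter across 1: the set of letters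
-- left of 1, a (j-1)-subset of {2, …, n}, is an invariant of the class, and moves act
-- independently on α (a copy of S_{j-1}) and on 1 β (a 1-squished permutation of n-j+1 letters).
-- The classes with a given left set are therefore counted by f(j-1) g(1,n-j+1), and summing over
-- the binom(n-1,j-1) subsets gives the recurrence, for every n ≥ 1.  When n ≤ c no move fits at
-- all, so g(1,m+1) = f(m) below c, and the recurrence collapses to
-- f(n) = Σ binom(n-1,k) k! (n-1-k)! = n!.

module Submission where

open import Defs
open import Data.Bool using (Bool; true; false; not)
open import Data.Empty using (⊥-elim)
open import Data.List using (List; []; _∷_; [_]; _++_; length; map; applyUpTo; upTo; cartesianProductWith)
open import Data.List.Properties using (length-++; length-map; length-upTo; map-++; map-∘; map-cong; map-injective; map-id-local; map-cong-local; map-applyUpTo; map-upTo; length-applyUpTo; upTo-∷ʳ; filter-some; filter-none; ++-assoc; ++-conicalˡ; ++-conicalʳ; ∷-injective; ∷-injectiveˡ; ∷-injectiveʳ; ++-identityʳ)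
open import Data.List.Membership.Propositional using (_∈_; _∉_; find)
open import Data.List.Membership.Propositional.Properties using (∈-∃++; ∈-++⁺ʳ)
open import Data.List.Relation.Binary.Permutation.Propositional using (_↭_; ↭-refl; ↭-sym; ↭-trans; ↭-prep; ↭-reflexive; ↭-isEquivalence)
open import Data.List.Relation.Binary.Permutation.Propositional.Properties using (↭-empty-inv; ∈-resp-↭; All-resp-↭; shift; drop-mid; drop-∷)
import Data.List.Relation.Binary.Permutation.Propositional.Properties as ↭
open import Data.List.Relation.Unary.All as All using (All; []; _∷_)
open import Data.List.Relation.Unary.Any as Any using (Any; here; there)
open import Data.List.Relation.Unary.AllPairs as AllPairs using (AllPairs; []; _∷_)
import Data.List.Relation.Unary.All.Properties as All
open import Data.List.Relation.Unary.All.Properties using (All¬⇒¬Any)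
import Data.List.Relation.Unary.Any.Properties as Any
import Data.List.Relation.Unary.AllPairs.Properties as AllPairs
open import Data.Nat using (ℕ; zero; suc; _+_; _*_; _∸_; _≤_; _<_; z≤n; s≤s; _!; _<?_)
open import Data.Nat.Properties
open import Data.Nat.ListAction using (sum)
open import Data.Nat.ListAction.Properties using (sum-++)
open import Data.Nat.Combinatorics using (_C_; nCk+nC[k+1]≡[n+1]C[k+1]; k>n⇒nCk≡0; nCk≡n!/k![n-k]!; k![n∸k]!∣n!)
open import Data.Nat.DivMod using (m/n*n≡m)
open import Data.Nat.Tactic.RingSolver using (solve-∀)
open import Data.Nat.Induction using (<-rec)
open import Data.Product using (Σ; ∃; ∃₂; _×_; _,_; proj₁; proj₂)
open import Data.Sum using (_⊎_; inj₁; inj₂; [_,_]′)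
open import Data.Maybe.Properties using (just-injective)
open import Data.Unit using (⊤; tt)
open import Function using (_∘_; id)
open import Level using (0ℓ)
open import Relation.Binary.Core using (Rel)
open import Relation.Binary.Definitions using (tri<; tri≈; tri>)
open import Relation.Nullary using (¬_)
open import Relation.Unary using (Pred)
open import Relation.Binary.Construct.Closure.Equivalence using (EqClosure)
import Relation.Binary.Construct.Closure.Equivalence as EqClosure
open import Relation.Binary.Construct.Closure.ReflexiveTransitive using (ε; _◅_; _◅◅_)
open import Relation.Binary.Construct.Closure.Symmetric using (fwd; bwd)
import Relation.Binary.Construct.Closure.Symmetric as SymClosure
open import Relation.Binary.PropositionalEquality hiding ([_])

-- Counting equivalence classes

record Transversal {A : Set} (P : Pred A 0ℓ) (_~_ : Rel A 0ℓ) (k : ℕ) : Set where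
  constructor mkTransversal
  field
    reps        : List A
    length-reps : length reps ≡ k
    reps-in-P   : All P reps
    reps-apart  : AllPairs (λ r s → ¬ r ~ s) reps
    covers      : ∀ {x} → P x → Any (x ~_) reps

open Transversal

module _ {A : Set} {Q : Pred A 0ℓ} where

  Any-split : ∀ {ys} → Any Q ys → ∃₂ λ ys₁ y → Σ (List A) λ ys₂ → ys ≡ ys₁ ++ y ∷ ys₂ × Q y
  Any-split q with find q
  ... | y , y∈ys , qy with ∈-∃++ y∈ys
  ...   | ys₁ , ys₂ , eq = ys₁ , y , ys₂ , eq , qy

  Any-remove : ∀ ys₁ {y ys₂} → ¬ Q y → Any Q (ys₁ ++ y ∷ ys₂) → Any Q (ys₁ ++ ys₂)
  Any-remove []        ¬qy (here qy) = ⊥-elim (¬qy qy)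
  Any-remove []        ¬qy (there q) = q
  Any-remove (_ ∷ ys₁) ¬qy (here q)  = here q
  Any-remove (_ ∷ ys₁) ¬qy (there q) = there (Any-remove ys₁ ¬qy q)

module _ {A : Set} {P : Pred A 0ℓ} where

  Any-zipAll : ∀ {Q R : Pred A 0ℓ} {xs} → (∀ {x} → P x → Q x → R x) → All P xs → Any Q xs → Any R xs
  Any-zipAll f (px ∷ _)   (here qx) = here (f px qx)
  Any-zipAll f (_  ∷ pxs) (there q) = there (Any-zipAll f pxs q)

  AllPairs-restrict : ∀ {R S : Rel A 0ℓ} {xs} → (∀ {x y} → P x → P y → R x y → S x y) →
                      All P xs → AllPairs R xs → AllPairs S xs
  AllPairs-restrict f []         []         = []
  AllPairs-restrict f (px ∷ pxs) (rx ∷ rxs) =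
    All.zipWith (λ (py , r) → f px py r) (pxs , rx) ∷ AllPairs-restrict f pxs rxs

module _ {A : Set} {_~_ : Rel A 0ℓ}
         (~-sym : ∀ {x y} → x ~ y → y ~ x) (~-trans : ∀ {x y z} → x ~ y → y ~ z → x ~ z) where

  apart-covered⇒length≤ : ∀ xs ys → AllPairs (λ r s → ¬ r ~ s) xs → All (λ x → Any (x ~_) ys) xs →
                          length xs ≤ length ys
  apart-covered⇒length≤ []       ys _           _           = z≤n
  apart-covered⇒length≤ (x ∷ xs) ys (x≁xs ∷ xs-apart) (x∈ys ∷ xs∈ys) with Any-split x∈ys
  ... | ys₁ , y , ys₂ , refl , x~y = begin
    suc (length xs)               ≤⟨ s≤s (apart-covered⇒length≤ xs (ys₁ ++ ys₂) xs-apart xs∈ys₁ys₂) ⟩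
    suc (length (ys₁ ++ ys₂))     ≡⟨ cong suc (length-++ ys₁) ⟩
    suc (length ys₁ + length ys₂) ≡⟨ sym (+-suc (length ys₁) (length ys₂)) ⟩
    length ys₁ + length (y ∷ ys₂) ≡⟨ sym (length-++ ys₁) ⟩
    length (ys₁ ++ y ∷ ys₂)       ∎
    where
    open ≤-Reasoning
    xs∈ys₁ys₂ : All (λ z → Any (z ~_) (ys₁ ++ ys₂)) xs
    xs∈ys₁ys₂ = All.zipWith (λ (x≁z , z∈ys) → Any-remove ys₁ (λ z~y → x≁z (~-trans x~y (~-sym z~y))) z∈ys)
                            (x≁xs , xs∈ys)

  Transversal-unique : ∀ {P k k'} → Transversal P _~_ k → Transversal P _~_ k' → k ≡ k'
  Transversal-unique t t' = subst₂ _≡_ (length-reps t) (length-reps t') (≤-antisym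
    (apart-covered⇒length≤ (reps t) (reps t') (reps-apart t) (All.map (covers t') (reps-in-P t)))
    (apart-covered⇒length≤ (reps t') (reps t) (reps-apart t') (All.map (covers t) (reps-in-P t'))))

module _ {A : Set} {_~_ : Rel A 0ℓ} where

  Transversal-resp : ∀ {P Q k} → (∀ {x} → P x → Q x) → (∀ {x} → Q x → P x) →
                     Transversal P _~_ k → Transversal Q _~_ k
  Transversal-resp P⇒Q Q⇒P (mkTransversal reps len inP apart covers) =
    mkTransversal reps len (All.map P⇒Q inP) apart (λ qx → covers (Q⇒P qx))

  Transversal-⊎ : ∀ {P Q k l} → (∀ {x y} → P x → Q y → ¬ x ~ y) →
                  Transversal P _~_ k → Transversal Q _~_ l → Transversal (λ x → P x ⊎ Q x) _~_ (k + l)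
  Transversal-⊎ P≁Q (mkTransversal reps₁ len₁ inP₁ apart₁ covers₁) (mkTransversal reps₂ len₂ inP₂ apart₂ covers₂) =
    mkTransversal (reps₁ ++ reps₂) (trans (length-++ reps₁) (cong₂ _+_ len₁ len₂))
      (All.++⁺ (All.map inj₁ inP₁) (All.map inj₂ inP₂))
      (AllPairs.++⁺ apart₁ apart₂ (All.map (λ px → All.map (P≁Q px) inP₂) inP₁))
      λ { (inj₁ px) → Any.++⁺ˡ (covers₁ px) ; (inj₂ qx) → Any.++⁺ʳ reps₁ (covers₂ qx) }

  Transversal-⋃ : ∀ {X : Set} {P : X → Pred A 0ℓ} (count : X → ℕ) (xs : List X) →
                  AllPairs _≢_ xs → (∀ {x y a b} → P x a → P y b → a ~ b → x ≡ y) →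
                  All (λ x → Transversal (P x) _~_ (count x)) xs →
                  Transversal (λ a → Any (λ x → P x a) xs) _~_ (sum (map count xs))
  Transversal-⋃ count [] [] _ [] =
    mkTransversal [] refl [] [] (λ ())
  Transversal-⋃ {P = P} count (x ∷ xs) (x≢xs ∷ xs-distinct) separated (t ∷ ts) =
    Transversal-resp [ here , there ]′ (λ { (here p) → inj₁ p ; (there p) → inj₂ p })
      (Transversal-⊎ disjoint t (Transversal-⋃ count xs xs-distinct separated ts))
    where
    disjoint : ∀ {a b} → P x a → Any (λ y → P y b) xs → ¬ a ~ b
    disjoint pa pbs a~b = All.lookupWith (λ x≢y pb → x≢y (separated pa pb a~b)) x≢xs pbs

Transversal-image : ∀ {A B : Set} {P : Pred A 0ℓ} {Q : Pred B 0ℓ} {_~_ : Rel A 0ℓ} {_≈_ : Rel B 0ℓ} {k}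
  (F : A → B) → (∀ {x y z} → x ≈ y → y ≈ z → x ≈ z) →
  (∀ {x} → P x → Q (F x)) →
  (∀ {x y} → P x → P y → x ~ y → F x ≈ F y) →
  (∀ {x y} → P x → P y → F x ≈ F y → x ~ y) →
  (∀ {z} → Q z → ∃ λ x → P x × z ≈ F x) →
  Transversal P _~_ k → Transversal Q _≈_ k
Transversal-image {_≈_ = _≈_} F ≈-trans F-pres F-resp F-reflect F-onto (mkTransversal reps len inP apart covers) =
  mkTransversal (map F reps) (trans (length-map F reps) len) (All.map⁺ (All.map F-pres inP))
    (AllPairs.map⁺ (AllPairs-restrict (λ px py x≁y Fx≈Fy → x≁y (F-reflect px py Fx≈Fy)) inP apart))
    covers′
  where
  covers′ : ∀ {z} → _ → Any (z ≈_) (map F reps)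
  covers′ qz with F-onto qz
  ... | x , px , z≈Fx = Any.map⁺ (Any-zipAll (λ pr x~r → ≈-trans z≈Fx (F-resp px pr x~r)) inP (covers px))

module _ {A B D : Set} (J : A → B → D) where

  length-cartesianProductWith : ∀ xs ys → length (cartesianProductWith J xs ys) ≡ length xs * length ys
  length-cartesianProductWith []       ys = refl
  length-cartesianProductWith (x ∷ xs) ys = trans (length-++ (map (J x) ys))
    (cong₂ _+_ (length-map (J x) ys) (length-cartesianProductWith xs ys))

  All-cartesianProductWith⁺ : ∀ {P : Pred A 0ℓ} {Q : Pred B 0ℓ} {R : Pred D 0ℓ} {xs ys} →
                              (∀ {x y} → P x → Q y → R (J x y)) →
                              All P xs → All Q ys → All R (cartesianProductWith J xs ys)
  All-cartesianProductWith⁺ pres []         qys = []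
  All-cartesianProductWith⁺ pres (px ∷ pxs) qys =
    All.++⁺ (All.map⁺ (All.map (pres px) qys)) (All-cartesianProductWith⁺ pres pxs qys)

  module _ {P : Pred A 0ℓ} {Q : Pred B 0ℓ} where

    AllPairs-cartesianProductWith⁺ : ∀ {R₁ : Rel A 0ℓ} {R₂ : Rel B 0ℓ} {S : Rel D 0ℓ} {xs ys} →
      (∀ {x x' y y'} → P x → P x' → Q y → Q y' → R₁ x x' → S (J x y) (J x' y')) →
      (∀ {x y y'} → P x → Q y → Q y' → R₂ y y' → S (J x y) (J x y')) →
      All P xs → All Q ys → AllPairs R₁ xs → AllPairs R₂ ys → AllPairs S (cartesianProductWith J xs ys)
    AllPairs-cartesianProductWith⁺ S₁ S₂ []         qys []           ys-apart = []
    AllPairs-cartesianProductWith⁺ {S = S} S₁ S₂ (px ∷ pxs) qys (x-R₁ ∷ xs-R₁) ys-apart =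
      AllPairs.++⁺ (AllPairs.map⁺ (AllPairs-restrict (S₂ px) qys ys-apart))
        (AllPairs-cartesianProductWith⁺ S₁ S₂ pxs qys xs-R₁ ys-apart)
        (All.map⁺ (All.map (λ qy → All-cartesianProductWith⁺ {P = λ x' → P x' × _} {R = S (J _ _)}
                                      (λ (px' , r) qy' → S₁ px px' qy qy' r) (All.zip (pxs , x-R₁)) qys) qys))

Transversal-× : ∀ {A B D : Set} {P : Pred A 0ℓ} {Q : Pred B 0ℓ} {R : Pred D 0ℓ}
  {_~_ : Rel A 0ℓ} {_≈_ : Rel B 0ℓ} {_≋_ : Rel D 0ℓ} {k l}
  (J : A → B → D) → (∀ {x y z} → x ≋ y → y ≋ z → x ≋ z) →
  (∀ {x y} → P x → Q y → R (J x y)) →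
  (∀ {x x' y y'} → P x → P x' → Q y → Q y' → x ~ x' → y ≈ y' → J x y ≋ J x' y') →
  (∀ {x x' y y'} → P x → P x' → Q y → Q y' → J x y ≋ J x' y' → x ~ x' × y ≈ y') →
  (∀ {z} → R z → ∃₂ λ x y → P x × Q y × z ≋ J x y) →
  Transversal P _~_ k → Transversal Q _≈_ l → Transversal R _≋_ (k * l)
Transversal-× {_≋_ = _≋_} J ≋-trans J-pres J-resp J-reflect J-onto
  (mkTransversal reps₁ len₁ inP apart₁ covers₁) (mkTransversal reps₂ len₂ inQ apart₂ covers₂) =
  mkTransversal (cartesianProductWith J reps₁ reps₂)
    (trans (length-cartesianProductWith J reps₁ reps₂) (cong₂ _*_ len₁ len₂))
    (All-cartesianProductWith⁺ J J-pres inP inQ)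
    (AllPairs-cartesianProductWith⁺ J
      (λ px px' qy qy' x≁x' J≋ → x≁x' (proj₁ (J-reflect px px' qy qy' J≋)))
      (λ px qy qy' y≉y' J≋ → y≉y' (proj₂ (J-reflect px px qy qy' J≋)))
      inP inQ apart₁ apart₂)
    covers′
  where
  covers′ : ∀ {z} → _ → Any (z ≋_) (cartesianProductWith J reps₁ reps₂)
  covers′ rz with J-onto rz
  ... | x , y , px , qy , z≋Jxy =
    Any.cartesianProductWith⁺ J (λ (pr , x~r) (qs , y≈s) → ≋-trans z≋Jxy (J-resp px pr qy qs x~r y≈s))
      (Any-zipAll _,_ inP (covers₁ px)) (Any-zipAll _,_ inQ (covers₂ qy))

-- Subsets of a list, as boolean masks

module _ {A : Set} where

  select : List Bool → List A → List A
  select []          _        = []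
  select (_ ∷ _)     []       = []
  select (true ∷ d)  (x ∷ xs) = x ∷ select d xs
  select (false ∷ d) (x ∷ xs) = select d xs

  select-complement : ∀ d xs → length d ≡ length xs → select d xs ++ select (map not d) xs ↭ xs
  select-complement []          []       _  = ↭-refl
  select-complement (true ∷ d)  (x ∷ xs) eq = ↭-prep x (select-complement d xs (suc-injective eq))
  select-complement (false ∷ d) (x ∷ xs) eq =
    ↭-trans (shift x (select d xs) _) (↭-prep x (select-complement d xs (suc-injective eq)))

  ++↭⇒select : ∀ xs ys zs → ys ++ zs ↭ xs →
             ∃ λ d → length d ≡ length xs × ys ↭ select d xs × zs ↭ select (map not d) xs
  ++↭⇒select []       ys zs p with ++-conicalˡ ys zs (↭-empty-inv p) | ++-conicalʳ ys zs (↭-empty-inv p)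
  ... | refl | refl = [] , refl , ↭-refl , ↭-refl
  ++↭⇒select (x ∷ xs) ys zs p with Any.++⁻ ys (∈-resp-↭ (↭-sym p) (here refl))
  ... | inj₁ x∈ys with ∈-∃++ x∈ys
  ...   | ys₁ , ys₂ , refl with ++↭⇒select xs (ys₁ ++ ys₂) zs (↭-trans (↭-reflexive (++-assoc ys₁ ys₂ zs))
                                  (drop-mid ys₁ [] (↭-trans (↭-reflexive (sym (++-assoc ys₁ (x ∷ ys₂) zs))) p)))
  ...     | d , len , ys₁ys₂↭ , zs↭ = true ∷ d , cong suc len , ↭-trans (shift x ys₁ ys₂) (↭-prep x ys₁ys₂↭) , zs↭
  ++↭⇒select (x ∷ xs) ys zs p | inj₂ x∈zs with ∈-∃++ x∈zs
  ...   | zs₁ , zs₂ , refl with ++↭⇒select xs ys (zs₁ ++ zs₂) (↭-trans (↭-reflexive (sym (++-assoc ys zs₁ zs₂)))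
                                  (drop-mid (ys ++ zs₁) [] (↭-trans (↭-reflexive (++-assoc ys zs₁ (x ∷ zs₂))) p)))
  ...     | d , len , ys↭ , zs₁zs₂↭ = false ∷ d , cong suc len , ys↭ , ↭-trans (shift x zs₁ zs₂) (↭-prep x zs₁zs₂↭)

  select⊆ : ∀ d xs {x} → x ∈ select d xs → x ∈ xs
  select⊆ (true ∷ d)  (y ∷ xs) (here eq) = here eq
  select⊆ (true ∷ d)  (y ∷ xs) (there m) = there (select⊆ d xs m)
  select⊆ (false ∷ d) (y ∷ xs) m         = there (select⊆ d xs m)

  All-select : ∀ {P : Pred A 0ℓ} d {xs} → All P xs → All P (select d xs)
  All-select d {xs} pxs = All.tabulate (λ m → All.lookup pxs (select⊆ d xs m))

  select-injective : ∀ {d d'} xs → length d ≡ length xs → length d' ≡ length xs → AllPairs _≢_ xs →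
                     select d xs ↭ select d' xs → d ≡ d'
  select-injective {[]}        {[]}         []       _   _    _              _ = refl
  select-injective {true ∷ d}  {true ∷ d'}  (x ∷ xs) len len' (_ ∷ distinct) p =
    cong (true ∷_) (select-injective xs (suc-injective len) (suc-injective len') distinct (drop-∷ p))
  select-injective {false ∷ d} {false ∷ d'} (x ∷ xs) len len' (_ ∷ distinct) p =
    cong (false ∷_) (select-injective xs (suc-injective len) (suc-injective len') distinct p)
  select-injective {true ∷ d}  {false ∷ d'} (x ∷ xs) _ _ (x∉xs ∷ _) p =
    ⊥-elim (All¬⇒¬Any x∉xs (select⊆ d' xs (∈-resp-↭ p (here refl))))
  select-injective {false ∷ d} {true ∷ d'}  (x ∷ xs) _ _ (x∉xs ∷ _) p =
    ⊥-elim (All¬⇒¬Any x∉xs (select⊆ d xs (∈-resp-↭ (↭-sym p) (here refl))))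

trues : List Bool → ℕ
trues []          = 0
trues (true ∷ d)  = suc (trues d)
trues (false ∷ d) = trues d

trues-not : ∀ d → trues (map not d) + trues d ≡ length d
trues-not []          = refl
trues-not (true ∷ d)  = trans (+-suc (trues (map not d)) (trues d)) (cong suc (trues-not d))
trues-not (false ∷ d) = cong suc (trues-not d)

allMasks : ℕ → List (List Bool)
allMasks zero    = [] ∷ []
allMasks (suc n) = map (false ∷_) (allMasks n) ++ map (true ∷_) (allMasks n)

allMasks-length : ∀ n → All (λ d → length d ≡ n) (allMasks n)
allMasks-length zero    = refl ∷ []
allMasks-length (suc n) = All.++⁺ (All.map⁺ (All.map (cong suc) (allMasks-length n)))
                                  (All.map⁺ (All.map (cong suc) (allMasks-length n)))

∈-allMasks : ∀ d → d ∈ allMasks (length d)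
∈-allMasks []          = here refl
∈-allMasks (false ∷ d) = Any.++⁺ˡ (Any.map⁺ (Any.map (cong (false ∷_)) (∈-allMasks d)))
∈-allMasks (true ∷ d)  = Any.++⁺ʳ (map (false ∷_) (allMasks (length d)))
                                  (Any.map⁺ (Any.map (cong (true ∷_)) (∈-allMasks d)))

allMasks-distinct : ∀ n → AllPairs _≢_ (allMasks n)
allMasks-distinct zero    = [] ∷ []
allMasks-distinct (suc n) =
  AllPairs.++⁺ (AllPairs.map⁺ (AllPairs.map (λ d≢d' → d≢d' ∘ ∷-injectiveʳ) (allMasks-distinct n)))
               (AllPairs.map⁺ (AllPairs.map (λ d≢d' → d≢d' ∘ ∷-injectiveʳ) (allMasks-distinct n)))
               (All.map⁺ (All.universal (λ _ → All.map⁺ (All.universal (λ _ ()) _)) _))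

nthTrue : List Bool → ℕ → ℕ
nthTrue []          i       = i
nthTrue (true ∷ d)  zero    = zero
nthTrue (true ∷ d)  (suc i) = suc (nthTrue d i)
nthTrue (false ∷ d) i       = suc (nthTrue d i)

rankTrue : List Bool → ℕ → ℕ
rankTrue []          y       = y
rankTrue (_ ∷ d)     zero    = zero
rankTrue (true ∷ d)  (suc y) = suc (rankTrue d y)
rankTrue (false ∷ d) (suc y) = rankTrue d y

rankTrue-nthTrue : ∀ d i → rankTrue d (nthTrue d i) ≡ i
rankTrue-nthTrue []          i       = refl
rankTrue-nthTrue (true ∷ d)  zero    = refl
rankTrue-nthTrue (true ∷ d)  (suc i) = cong suc (rankTrue-nthTrue d i)
rankTrue-nthTrue (false ∷ d) i       = rankTrue-nthTrue d i

nthTrue-mono-< : ∀ d {i j} → i < j → nthTrue d i < nthTrue d j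
nthTrue-mono-< []          i<j             = i<j
nthTrue-mono-< (true ∷ d)  {zero}  {suc j} _ = s≤s z≤n
nthTrue-mono-< (true ∷ d)  {suc i} {suc j} (s≤s i<j) = s≤s (nthTrue-mono-< d i<j)
nthTrue-mono-< (false ∷ d) i<j             = s≤s (nthTrue-mono-< d i<j)

select-applyUpTo : ∀ {A : Set} d (f : ℕ → A) → select d (applyUpTo f (length d)) ≡ applyUpTo (f ∘ nthTrue d) (trues d)
select-applyUpTo []          f = refl
select-applyUpTo (true ∷ d)  f = cong (f 0 ∷_) (select-applyUpTo d (f ∘ suc))
select-applyUpTo (false ∷ d) f = select-applyUpTo d (f ∘ suc)

-- Sends the letters 1, 2, … increasingly onto the positions (counted from 1) of the trues of d.
relabel : List Bool → ℕ → ℕ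
relabel d zero    = zero
relabel d (suc i) = suc (nthTrue d i)

unrelabel : List Bool → ℕ → ℕ
unrelabel d zero    = zero
unrelabel d (suc y) = suc (rankTrue d y)

unrelabel-relabel : ∀ d x → unrelabel d (relabel d x) ≡ x
unrelabel-relabel d zero    = refl
unrelabel-relabel d (suc i) = cong suc (rankTrue-nthTrue d i)

relabel-mono-< : ∀ d {x y} → x < y → relabel d x < relabel d y
relabel-mono-< d {zero}  {suc y} _         = s≤s z≤n
relabel-mono-< d {suc x} {suc y} (s≤s x<y) = s≤s (nthTrue-mono-< d x<y)

map-relabel-applyUpTo : ∀ d → map (relabel d) (applyUpTo suc (trues d)) ≡ select d (applyUpTo suc (length d))
map-relabel-applyUpTo d = trans (map-applyUpTo suc (relabel d) (trues d)) (sym (select-applyUpTo d suc))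

relabel-cancel-< : ∀ d {x y} → relabel d x < relabel d y → x < y
relabel-cancel-< d {x} {y} lt with <-cmp x y
... | tri< x<y _ _ = x<y
... | tri≈ _ refl _ = ⊥-elim (<-irrefl refl lt)
... | tri> _ _ y<x = ⊥-elim (<-asym lt (relabel-mono-< d y<x))

InImage : List Bool → Pred ℕ 0ℓ
InImage d y = ∃ λ x → y ≡ relabel d x

All-InImage-map : ∀ d xs → All (InImage d) (map (relabel d) xs)
All-InImage-map d xs = All.map⁺ (All.universal (_, refl) xs)

map-unrelabel-relabel : ∀ d xs → map (unrelabel d) (map (relabel d) xs) ≡ xs
map-unrelabel-relabel d xs = trans (sym (map-∘ xs)) (map-id-local (All.universal (unrelabel-relabel d) xs))

map-relabel-unrelabel : ∀ d {ys} → All (InImage d) ys → map (relabel d) (map (unrelabel d) ys) ≡ ys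
map-relabel-unrelabel d {ys} inImage = trans (sym (map-∘ ys))
  (map-id-local (All.map (λ { (x , refl) → cong (relabel d) (unrelabel-relabel d x) }) inImage))

unrelabel-cancel-< : ∀ d {x y} → InImage d x → InImage d y → unrelabel d x < unrelabel d y → x < y
unrelabel-cancel-< d (x , refl) (y , refl) lt =
  relabel-mono-< d (subst₂ _<_ (unrelabel-relabel d x) (unrelabel-relabel d y) lt)

-- Moves on arbitrary words

-- Between two permutations of S_n a move always relates rearrangements of each other; for
-- arbitrary words this has to be recorded.
Step : ℕ → Rel Word 0ℓ
Step c φ ψ = Move c φ ψ × φ ↭ ψ

MoveEquiv : ℕ → Rel Word 0ℓ
MoveEquiv c = EqClosure (Step c)

Step-sym : ∀ {c φ ψ} → Step c φ ψ → Step c ψ φ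
Step-sym ((a , b , u , v , φ≡ , ψ≡ , |u| , |v| , u-min , v-min) , φ↭ψ) =
  (a , b , v , u , ψ≡ , φ≡ , |v| , |u| , v-min , u-min) , ↭-sym φ↭ψ

MoveEquiv⇒↭ : ∀ {c φ ψ} → MoveEquiv c φ ψ → φ ↭ ψ
MoveEquiv⇒↭ = EqClosure.fold ↭-isEquivalence proj₂

Equiv⇒MoveEquiv : ∀ {c n φ ψ} → Equiv c n φ ψ → MoveEquiv c φ ψ
Equiv⇒MoveEquiv = EqClosure.map λ (φ∈Sₙ , ψ∈Sₙ , m) → m , ↭-trans φ∈Sₙ (↭-sym ψ∈Sₙ)

MoveEquiv⇒Equiv : ∀ {c n φ ψ} → IsPerm n φ → MoveEquiv c φ ψ → Equiv c n φ ψ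
MoveEquiv⇒Equiv φ∈Sₙ ε = ε
MoveEquiv⇒Equiv φ∈Sₙ (s ◅ ss) with SymClosure.fold Step-sym id s
... | m , φ↭χ = let χ∈Sₙ = ↭-trans (↭-sym φ↭χ) φ∈Sₙ in fwd (φ∈Sₙ , χ∈Sₙ , m) ◅ MoveEquiv⇒Equiv χ∈Sₙ ss

MoveEquiv-++ʳ : ∀ {c φ ψ} z → MoveEquiv c φ ψ → MoveEquiv c (φ ++ z) (ψ ++ z)
MoveEquiv-++ʳ z = EqClosure.gmap (_++ z) λ { ((a , b , u , v , refl , refl , lens) , φ↭ψ) →
  (a , b ++ z , u , v , ++-assoc₃ a u b z , ++-assoc₃ a v b z , lens) , ↭.++⁺ʳ z φ↭ψ }
  where
  ++-assoc₃ : ∀ (a u b z : Word) → (a ++ (u ++ b)) ++ z ≡ a ++ (u ++ (b ++ z))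
  ++-assoc₃ a u b z = trans (++-assoc a (u ++ b) z) (cong (a ++_) (++-assoc u b z))

MoveEquiv-++ˡ : ∀ {c φ ψ} z → MoveEquiv c φ ψ → MoveEquiv c (z ++ φ) (z ++ ψ)
MoveEquiv-++ˡ z = EqClosure.gmap (z ++_) λ { ((a , b , u , v , refl , refl , lens) , φ↭ψ) →
  (z ++ a , b , u , v , sym (++-assoc z a _) , sym (++-assoc z a _) , lens) , ↭.++⁺ˡ z φ↭ψ }

BeginsWith1⇒minimum : ∀ {x w} → BeginsWith1 (x ∷ w) → All (λ y → ¬ y < x) (x ∷ w)
BeginsWith1⇒minimum {x} b = All.¬Any⇒All¬ _ λ smaller →
  <⇒≢ (filter-some (_<? x) smaller) (sym (suc-injective (just-injective b)))

minimum⇒BeginsWith1 : ∀ {x w} → All (λ y → ¬ y < x) (x ∷ w) → BeginsWith1 (x ∷ w)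
minimum⇒BeginsWith1 {x} minimum rewrite filter-none (_<? x) minimum = refl

module _ (g : ℕ → ℕ) {Good : Pred ℕ 0ℓ} (g-cancel-< : ∀ {x y} → Good x → Good y → g x < g y → x < y) where

  BeginsWith1-map : ∀ {u} → All Good u → BeginsWith1 u → BeginsWith1 (map g u)
  BeginsWith1-map {x ∷ w} good b = minimum⇒BeginsWith1 (All.map⁺ (All.zipWith
    (λ (y≮x , good-y) gy<gx → y≮x (g-cancel-< good-y (All.head good) gy<gx)) (BeginsWith1⇒minimum b , good)))

  Step-map : ∀ {c φ ψ} → All Good φ → All Good ψ → Step c φ ψ → Step c (map g φ) (map g ψ)
  Step-map good-φ good-ψ ((a , b , u , v , refl , refl , |u| , |v| , u-min , v-min) , φ↭ψ) =
    (map g a , map g b , map g u , map g v , map-++₃ a u b , map-++₃ a v b ,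
     trans (length-map g u) |u| , trans (length-map g v) |v| ,
     BeginsWith1-map (All.++⁻ˡ u (All.++⁻ʳ a good-φ)) u-min ,
     BeginsWith1-map (All.++⁻ˡ v (All.++⁻ʳ a good-ψ)) v-min) , ↭.map⁺ g φ↭ψ
    where
    map-++₃ : ∀ a u b → map g (a ++ (u ++ b)) ≡ map g a ++ (map g u ++ map g b)
    map-++₃ a u b = trans (map-++ g a (u ++ b)) (cong (map g a ++_) (map-++ g u b))

  MoveEquiv-map : ∀ {c φ ψ} → All Good φ → MoveEquiv c φ ψ → MoveEquiv c (map g φ) (map g ψ)
  MoveEquiv-map good-φ ε        = ε
  MoveEquiv-map good-φ (s ◅ ss) with SymClosure.fold Step-sym id s
  ... | step@(_ , φ↭χ) = let good-χ = All-resp-↭ φ↭χ good-φ in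
    fwd (Step-map good-φ good-χ step) ◅ MoveEquiv-map good-χ ss

MoveEquiv-relabel : ∀ {c} d {σ σ′} → MoveEquiv c σ σ′ → MoveEquiv c (map (relabel d) σ) (map (relabel d) σ′)
MoveEquiv-relabel d {σ} = MoveEquiv-map (relabel d) {Good = λ _ → ⊤} (λ _ _ → relabel-cancel-< d) (All.universal _ σ)

MoveEquiv-relabel⁻ : ∀ {c} d {σ σ′} → MoveEquiv c (map (relabel d) σ) (map (relabel d) σ′) → MoveEquiv c σ σ′
MoveEquiv-relabel⁻ d {σ} {σ′} e = subst₂ (MoveEquiv _) (map-unrelabel-relabel d σ) (map-unrelabel-relabel d σ′)
  (MoveEquiv-map (unrelabel d) (unrelabel-cancel-< d) (All-InImage-map d σ) e)

module _ {A : Set} where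

  split-++≡++∷ : ∀ (xs ys α β : List A) z → xs ++ ys ≡ α ++ z ∷ β →
                 (∃ λ p → xs ≡ α ++ z ∷ p × β ≡ p ++ ys) ⊎ (∃ λ q → α ≡ xs ++ q × ys ≡ q ++ z ∷ β)
  split-++≡++∷ []       ys α       β z eq = inj₂ (α , refl , eq)
  split-++≡++∷ (x ∷ xs) ys []      β z eq with ∷-injective eq
  ... | refl , eq′ = inj₁ (xs , refl , sym eq′)
  split-++≡++∷ (x ∷ xs) ys (a ∷ α) β z eq with ∷-injective eq
  ... | refl , eq′ with split-++≡++∷ xs ys α β z eq′
  ...   | inj₁ (p , xs≡ , β≡) = inj₁ (p , cong (x ∷_) xs≡ , β≡)
  ...   | inj₂ (q , α≡ , ys≡) = inj₂ (q , cong (x ∷_) α≡ , ys≡)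

  ++∷-injective : ∀ {z : A} α₁ α₂ {β₁ β₂} → z ∉ α₁ → z ∉ α₂ →
                  α₁ ++ z ∷ β₁ ≡ α₂ ++ z ∷ β₂ → α₁ ≡ α₂ × β₁ ≡ β₂
  ++∷-injective []       []       _     _     refl = refl , refl
  ++∷-injective []       (a ∷ α₂) _     z∉α₂  eq   = ⊥-elim (z∉α₂ (here (∷-injectiveˡ eq)))
  ++∷-injective (a ∷ α₁) []       z∉α₁  _     eq   = ⊥-elim (z∉α₁ (here (sym (∷-injectiveˡ eq))))
  ++∷-injective (a ∷ α₁) (b ∷ α₂) z∉α₁  z∉α₂  eq with ∷-injective eq
  ... | refl , eq′ with ++∷-injective α₁ α₂ (z∉α₁ ∘ there) (z∉α₂ ∘ there) eq′
  ...   | refl , refl = refl , refl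

  ↭-++-cancelˡ : ∀ (xs : List A) {ys zs} → xs ++ ys ↭ xs ++ zs → ys ↭ zs
  ↭-++-cancelˡ []       p = p
  ↭-++-cancelˡ (x ∷ xs) p = ↭-++-cancelˡ xs (drop-∷ p)

  ↭-++-cancelʳ : ∀ (xs : List A) {ys zs} → ys ++ xs ↭ zs ++ xs → ys ↭ zs
  ↭-++-cancelʳ xs {ys} {zs} p = ↭-++-cancelˡ xs (↭-trans (↭.++-comm xs ys) (↭-trans p (↭.++-comm zs xs)))

BeginsWith1-no-prefix-before-1 : ∀ {q p} → All (2 ≤_) q → BeginsWith1 (q ++ 1 ∷ p) → q ≡ []
BeginsWith1-no-prefix-before-1 {[]}    _          _ = refl
BeginsWith1-no-prefix-before-1 {y ∷ q} (2≤y ∷ _) b =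
  ⊥-elim (All.lookup (BeginsWith1⇒minimum b) (∈-++⁺ʳ (y ∷ q) (here refl)) 2≤y)

BeginsWith1-↭-1∷ : ∀ {p v} → All (1 ≤_) p → 1 ∷ p ↭ v → BeginsWith1 v → ∃ λ v′ → v ≡ 1 ∷ v′
BeginsWith1-↭-1∷ {v = x ∷ v′} 1≤p 1∷p↭v b with
  ≤-antisym (≮⇒≥ (All.lookup (BeginsWith1⇒minimum b) (∈-resp-↭ 1∷p↭v (here refl))))
            (All.lookup (s≤s z≤n ∷ 1≤p) (∈-resp-↭ (↭-sym 1∷p↭v) (here refl)))
... | refl = v′ , refl

SplitAt1 : ℕ → Word → Word → Word → Set
SplitAt1 c α β ψ = ∃₂ λ α′ β′ → ψ ≡ α′ ++ 1 ∷ β′ × MoveEquiv c α α′ × MoveEquiv c (1 ∷ β) (1 ∷ β′)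

Step-split-at-1 : ∀ {c ψ} α β → Step c (α ++ 1 ∷ β) ψ → All (2 ≤_) α → All (1 ≤_) β → SplitAt1 c α β ψ
Step-split-at-1 α β ((a , b , u , v , φ≡ , refl , |u| , |v| , u-min , v-min) , φ↭ψ) 2≤α 1≤β
  with ↭-++-cancelʳ b (↭-++-cancelˡ a (subst (_↭ _) φ≡ φ↭ψ)) | split-++≡++∷ a (u ++ b) α β 1 (sym φ≡)
... | u↭v | inj₁ (p , refl , refl) =
  α , p ++ (v ++ b) , ++-assoc α (1 ∷ p) (v ++ b) , ε ,
  fwd ((1 ∷ p , b , u , v , refl , refl , |u| , |v| , u-min , v-min) , ↭.zoom (1 ∷ p) u↭v) ◅ ε
... | u↭v | inj₂ (q , refl , u++b≡) with split-++≡++∷ u b q β 1 u++b≡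
...   | inj₂ (q′ , refl , refl) =
  a ++ (v ++ q′) , β , sym (trans (++-assoc a (v ++ q′) (1 ∷ β)) (cong (a ++_) (++-assoc v q′ (1 ∷ β)))) ,
  fwd ((a , q′ , u , v , refl , refl , |u| , |v| , u-min , v-min) , ↭.zoom a u↭v) ◅ ε , ε
...   | inj₁ (p , refl , refl)
  with BeginsWith1-no-prefix-before-1 (All.++⁻ʳ a 2≤α) u-min
...     | refl with BeginsWith1-↭-1∷ (All.++⁻ˡ p 1≤β) u↭v v-min
...       | v′ , refl =
  a ++ [] , v′ ++ b , cong (_++ (1 ∷ v′ ++ b)) (sym (++-identityʳ a)) , ε ,
  fwd (([] , b , 1 ∷ p , 1 ∷ v′ , refl , refl , |u| , |v| , u-min , v-min) , ↭.++⁺ʳ b u↭v) ◅ ε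

MoveEquiv-split-at-1 : ∀ {c ψ} α β → MoveEquiv c (α ++ 1 ∷ β) ψ → All (2 ≤_) α → All (1 ≤_) β →
                       SplitAt1 c α β ψ
MoveEquiv-split-at-1 α β ε        _   _   = α , β , refl , ε , ε
MoveEquiv-split-at-1 α β (s ◅ ss) 2≤α 1≤β with Step-split-at-1 α β (SymClosure.fold Step-sym id s) 2≤α 1≤β
... | α₁ , β₁ , refl , α~α₁ , 1β~1β₁
  with MoveEquiv-split-at-1 α₁ β₁ ss (All-resp-↭ (MoveEquiv⇒↭ α~α₁) 2≤α)
                            (All-resp-↭ (drop-∷ (MoveEquiv⇒↭ 1β~1β₁)) 1≤β)
...   | α′ , β′ , ψ≡ , α₁~α′ , 1β₁~1β′ = α′ , β′ , ψ≡ , α~α₁ ◅◅ α₁~α′ , 1β~1β₁ ◅◅ 1β₁~1β′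

-- Binomial sums

sum-map-+ : ∀ {A : Set} (xs : List A) f g → sum (map (λ x → f x + g x) xs) ≡ sum (map f xs) + sum (map g xs)
sum-map-+ []       f g = refl
sum-map-+ (x ∷ xs) f g = trans (cong (f x + g x +_) (sum-map-+ xs f g)) (+-+-swap (f x) (g x) _ _)
  where
  +-+-swap : ∀ a b c d → a + b + (c + d) ≡ a + c + (b + d)
  +-+-swap = solve-∀

sum-upTo-suc : ∀ n (f : ℕ → ℕ) → sum (map f (upTo (suc n))) ≡ f 0 + sum (map (f ∘ suc) (upTo n))
sum-upTo-suc n f = cong (λ xs → f 0 + sum xs) (trans (map-applyUpTo suc f n) (sym (map-upTo (f ∘ suc) n)))

sum-upTo-∷ʳ : ∀ n (f : ℕ → ℕ) → sum (map f (upTo (suc n))) ≡ sum (map f (upTo n)) + f n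
sum-upTo-∷ʳ n f = begin
  sum (map f (upTo (suc n)))         ≡⟨ cong (sum ∘ map f) (upTo-∷ʳ n) ⟨
  sum (map f (upTo n ++ [ n ]))      ≡⟨ cong sum (map-++ f (upTo n) [ n ]) ⟩
  sum (map f (upTo n) ++ [ f n ])    ≡⟨ sum-++ (map f (upTo n)) [ f n ] ⟩
  sum (map f (upTo n)) + (f n + 0)   ≡⟨ cong (sum (map f (upTo n)) +_) (+-identityʳ (f n)) ⟩
  sum (map f (upTo n)) + f n         ∎
  where open ≡-Reasoning

binomialSum : ℕ → (ℕ → ℕ) → ℕ
binomialSum n F = sum (map (λ k → (n C k) * F k) (upTo (suc n)))

binomialSum-suc : ∀ n F → binomialSum (suc n) F ≡ binomialSum n F + binomialSum n (F ∘ suc)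
binomialSum-suc n F = begin
  binomialSum (suc n) F
    ≡⟨ sum-upTo-suc (suc n) (λ k → (suc n C k) * F k) ⟩
  F 0 + 0 + sum (map (λ k → (suc n C suc k) * F (suc k)) (upTo (suc n)))
    ≡⟨ cong (F 0 + 0 +_) (cong sum (map-cong pascal (upTo (suc n)))) ⟩
  F 0 + 0 + sum (map (λ k → (n C k) * F (suc k) + (n C suc k) * F (suc k)) (upTo (suc n)))
    ≡⟨ cong (F 0 + 0 +_) (sum-map-+ (upTo (suc n)) (λ k → (n C k) * F (suc k)) G) ⟩
  F 0 + 0 + (binomialSum n (F ∘ suc) + sum (map G (upTo (suc n))))
    ≡⟨ cong (λ s → F 0 + 0 + (binomialSum n (F ∘ suc) + s)) last-term-vanishes ⟩
  F 0 + 0 + (binomialSum n (F ∘ suc) + sum (map G (upTo n)))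
    ≡⟨ +-rotate (F 0 + 0) (binomialSum n (F ∘ suc)) (sum (map G (upTo n))) ⟩
  F 0 + 0 + sum (map G (upTo n)) + binomialSum n (F ∘ suc)
    ≡⟨ cong (_+ binomialSum n (F ∘ suc)) (sum-upTo-suc n (λ k → (n C k) * F k)) ⟨
  binomialSum n F + binomialSum n (F ∘ suc) ∎
  where
  open ≡-Reasoning
  G : ℕ → ℕ
  G k = (n C suc k) * F (suc k)
  pascal : ∀ k → (suc n C suc k) * F (suc k) ≡ (n C k) * F (suc k) + G k
  pascal k = trans (cong (_* F (suc k)) (sym (nCk+nC[k+1]≡[n+1]C[k+1] n k)))
                   (*-distribʳ-+ (F (suc k)) (n C k) (n C suc k))
  last-term-vanishes : sum (map G (upTo (suc n))) ≡ sum (map G (upTo n))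
  last-term-vanishes = trans (sum-upTo-∷ʳ n G)
    (trans (cong (λ x → sum (map G (upTo n)) + x * F (suc n)) (k>n⇒nCk≡0 (n<1+n n))) (+-identityʳ _))
  +-rotate : ∀ a b c → a + (b + c) ≡ a + c + b
  +-rotate = solve-∀

sum-allMasks : ∀ n (F : ℕ → ℕ) → sum (map (F ∘ trues) (allMasks n)) ≡ binomialSum n F
sum-allMasks zero    F = cong (_+ 0) (sym (+-identityʳ (F 0)))
sum-allMasks (suc n) F = begin
  sum (map (F ∘ trues) (map (false ∷_) (allMasks n) ++ map (true ∷_) (allMasks n)))
    ≡⟨ cong sum (map-++ (F ∘ trues) (map (false ∷_) (allMasks n)) _) ⟩
  sum (map (F ∘ trues) (map (false ∷_) (allMasks n)) ++ map (F ∘ trues) (map (true ∷_) (allMasks n)))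
    ≡⟨ sum-++ (map (F ∘ trues) (map (false ∷_) (allMasks n))) _ ⟩
  sum (map (F ∘ trues) (map (false ∷_) (allMasks n))) + sum (map (F ∘ trues) (map (true ∷_) (allMasks n)))
    ≡⟨ cong₂ _+_ (cong sum (map-∘ (allMasks n))) (cong sum (map-∘ (allMasks n))) ⟨
  sum (map (F ∘ trues) (allMasks n)) + sum (map (F ∘ suc ∘ trues) (allMasks n))
    ≡⟨ cong₂ _+_ (sum-allMasks n F) (sum-allMasks n (F ∘ suc)) ⟩
  binomialSum n F + binomialSum n (F ∘ suc)
    ≡⟨ binomialSum-suc n F ⟨
  binomialSum (suc n) F ∎
  where open ≡-Reasoning

nCk*[k!*[n∸k]!]≡n! : ∀ {n k} → k ≤ n → (n C k) * (k ! * (n ∸ k) !) ≡ n !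
nCk*[k!*[n∸k]!]≡n! {n} {k} k≤n =
  trans (cong (_* (k ! * (n ∸ k) !)) (nCk≡n!/k![n-k]! k≤n)) (m/n*n≡m (k![n∸k]!∣n! k≤n))
  where instance _ = k !* (n ∸ k) !≢0

binomialSum-factorials : ∀ n → binomialSum n (λ k → k ! * (n ∸ k) !) ≡ suc n !
binomialSum-factorials n = begin
  binomialSum n (λ k → k ! * (n ∸ k) !)        ≡⟨ cong sum (map-cong-local (All.applyUpTo⁺₁ id (suc n) λ k≤n →
                                                    nCk*[k!*[n∸k]!]≡n! (≤-pred k≤n))) ⟩
  sum (map (λ _ → n !) (upTo (suc n)))         ≡⟨ sum-map-const (upTo (suc n)) ⟩
  length (upTo (suc n)) * n !                  ≡⟨ cong (_* n !) (length-upTo (suc n)) ⟩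
  suc n * n !                                  ∎
  where
  open ≡-Reasoning
  sum-map-const : ∀ {A : Set} (xs : List A) {c} → sum (map (λ _ → c) xs) ≡ length xs * c
  sum-map-const []       = refl
  sum-map-const (_ ∷ xs) = cong (_ +_) (sum-map-const xs)

-- Permutations and their classes

IsPerm⇒↭applyUpTo : ∀ {m σ} → IsPerm m σ → σ ↭ applyUpTo suc m
IsPerm⇒↭applyUpTo {m} σ∈Sₘ = ↭-trans σ∈Sₘ (↭-reflexive (map-upTo suc m))

↭applyUpTo⇒IsPerm : ∀ {m σ} → σ ↭ applyUpTo suc m → IsPerm m σ
↭applyUpTo⇒IsPerm {m} σ↭ = ↭-trans σ↭ (↭-reflexive (sym (map-upTo suc m)))

IsPerm-length : ∀ {n φ} → IsPerm n φ → length φ ≡ n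
IsPerm-length {n} φ∈Sₙ = trans (↭.↭-length φ∈Sₙ) (trans (length-map suc (upTo n)) (length-upTo n))

Move⇒length≥ : ∀ {c φ ψ} → Move c φ ψ → suc c ≤ length φ
Move⇒length≥ {c} (a , b , u , v , refl , _ , |u| , _) = begin
  suc c                        ≡⟨ |u| ⟨
  length u                     ≤⟨ m≤m+n (length u) (length b) ⟩
  length u + length b          ≡⟨ length-++ u ⟨
  length (u ++ b)              ≤⟨ m≤n+m _ (length a) ⟩
  length a + length (u ++ b)   ≡⟨ length-++ a ⟨
  length (a ++ (u ++ b))       ∎
  where open ≤-Reasoning

no-move : ∀ {c n φ ψ} → n < suc c → IsPerm n φ → ¬ Move c φ ψ
no-move n≤c φ∈Sₙ m = <-irrefl refl (<-≤-trans n≤c (subst (_ ≤_) (IsPerm-length φ∈Sₙ) (Move⇒length≥ m)))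

Equiv-trivial : ∀ {c n φ ψ} → n < suc c → Equiv c n φ ψ → φ ≡ ψ
Equiv-trivial n≤c ε                       = refl
Equiv-trivial n≤c (fwd (χ∈Sₙ , _ , m) ◅ _) = ⊥-elim (no-move n≤c χ∈Sₙ m)
Equiv-trivial n≤c (bwd (χ∈Sₙ , _ , m) ◅ _) = ⊥-elim (no-move n≤c χ∈Sₙ m)

ClassesMeeting⇒Transversal : ∀ {c n P k} → ClassesMeeting c n P k →
                             Transversal (λ φ → IsPerm n φ × P φ) (Equiv c n) k
ClassesMeeting⇒Transversal (reps , len , inP , apart , covers) =
  mkTransversal reps len inP apart (λ (φ∈Sₙ , pφ) → covers _ φ∈Sₙ pφ)

Equiv-count-unique : ∀ {c n P k k'} → Transversal P (Equiv c n) k → Transversal P (Equiv c n) k' → k ≡ k'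
Equiv-count-unique {c} {n} = Transversal-unique (EqClosure.symmetric (MoveIn c n)) (EqClosure.transitive (MoveIn c n))

≡⇒Equiv : ∀ {c n φ ψ} → φ ≡ ψ → Equiv c n φ ψ
≡⇒Equiv refl = ε

Squished : ℕ → Pred Word 0ℓ
Squished m τ = IsPerm m τ × Squished1 τ

Squished1⇒1∷ : ∀ {τ} → Squished1 τ → ∃ λ τ₀ → τ ≡ 1 ∷ τ₀
Squished1⇒1∷ {x ∷ τ₀} sq with just-injective sq
... | refl = τ₀ , refl

-- Splitting a permutation of S_{N+1} at the letter 1

letters≥2 : ℕ → Word
letters≥2 N = applyUpTo (suc ∘ suc) N

letters≥2-≥2 : ∀ N → All (2 ≤_) (letters≥2 N)
letters≥2-≥2 N = All.applyUpTo⁺₂ _ N (λ _ → s≤s (s≤s z≤n))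

letters≥2-distinct : ∀ N → AllPairs _≢_ (letters≥2 N)
letters≥2-distinct N = AllPairs.applyUpTo⁺₁ _ N (λ i<j _ eq → <⇒≢ i<j (suc-injective (suc-injective eq)))

length-letters≥2 : ∀ N → length (letters≥2 N) ≡ N
length-letters≥2 = length-applyUpTo (suc ∘ suc)

-- φ = α 1 β, where b marks which of the letters 2, …, N+1 lie in α.
record SplitBy (N : ℕ) (b : List Bool) (φ : Word) : Set where
  constructor splitBy
  field
    mask-length : length b ≡ N
    α β         : Word
    φ≡α1β       : φ ≡ α ++ 1 ∷ β
    α↭          : α ↭ select b (letters≥2 N)
    β↭          : β ↭ select (map not b) (letters≥2 N)

↭select-letters≥2⇒≥2 : ∀ N b {α} → α ↭ select b (letters≥2 N) → All (2 ≤_) α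
↭select-letters≥2⇒≥2 N b α↭ = All-resp-↭ (↭-sym α↭) (All-select b (letters≥2-≥2 N))

≥2⇒≥1 : ∀ {xs} → All (2 ≤_) xs → All (1 ≤_) xs
≥2⇒≥1 = All.map (≤-trans (n≤1+n 1))

≥2⇒1∉ : ∀ {xs} → All (2 ≤_) xs → 1 ∉ xs
≥2⇒1∉ 2≤xs 1∈xs = <-irrefl refl (All.lookup 2≤xs 1∈xs)

SplitBy⇒IsPerm : ∀ {N b φ} → SplitBy N b φ → IsPerm (suc N) φ
SplitBy⇒IsPerm {N} {b} (splitBy |b| α β refl α↭ β↭) = ↭applyUpTo⇒IsPerm (↭-trans (shift 1 α β) (↭-prep 1
  (↭-trans (↭.++⁺ α↭ β↭) (select-complement b (letters≥2 N) (trans |b| (sym (length-letters≥2 N)))))))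

IsPerm⇒SplitBy : ∀ {N φ} → IsPerm (suc N) φ → Any (λ b → SplitBy N b φ) (allMasks N)
IsPerm⇒SplitBy {N} φ∈Sₙ₊₁ with ∈-∃++ (∈-resp-↭ (↭-sym (IsPerm⇒↭applyUpTo φ∈Sₙ₊₁)) (here refl))
... | α , β , refl
  with ++↭⇒select (letters≥2 N) α β (drop-∷ (↭-trans (↭-sym (shift 1 α β)) (IsPerm⇒↭applyUpTo φ∈Sₙ₊₁)))
...   | b , |b|′ , α↭ , β↭ =
  Any.map (λ { refl → splitBy |b| α β refl α↭ β↭ }) (subst (λ n → b ∈ allMasks n) |b| (∈-allMasks b))
  where
  |b| : length b ≡ N
  |b| = trans |b|′ (length-letters≥2 N)

SplitBy-mask-invariant : ∀ {c N b b′ φ ψ} → SplitBy N b φ → SplitBy N b′ ψ → Equiv c (suc N) φ ψ → b ≡ b′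
SplitBy-mask-invariant {N = N} {b} {b′} (splitBy |b| α β refl α↭ β↭) (splitBy |b′| α₂ β₂ refl α₂↭ β₂↭) φ~ψ
  with MoveEquiv-split-at-1 α β (Equiv⇒MoveEquiv φ~ψ) (↭select-letters≥2⇒≥2 N b α↭)
                            (≥2⇒≥1 (↭select-letters≥2⇒≥2 N (map not b) β↭))
... | α′ , β′ , ψ≡ , α~α′ , _
  with ++∷-injective α′ α₂ (≥2⇒1∉ (All-resp-↭ (MoveEquiv⇒↭ α~α′) (↭select-letters≥2⇒≥2 N b α↭)))
                           (≥2⇒1∉ (↭select-letters≥2⇒≥2 N b′ α₂↭)) (sym ψ≡)
...   | refl , refl = select-injective (letters≥2 N)
  (trans |b| (sym (length-letters≥2 N))) (trans |b′| (sym (length-letters≥2 N))) (letters≥2-distinct N)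
  (↭-trans (↭-sym α↭) (↭-trans (MoveEquiv⇒↭ α~α′) α₂↭))

↭relabel⇒InImage : ∀ d {xs ys} → xs ↭ map (relabel d) ys → All (InImage d) xs
↭relabel⇒InImage d {ys = ys} xs↭ = All-resp-↭ (↭-sym xs↭) (All-InImage-map d ys)

↭relabel⇒unrelabel-IsPerm : ∀ d {xs n} → xs ↭ map (relabel d) (applyUpTo suc n) → IsPerm n (map (unrelabel d) xs)
↭relabel⇒unrelabel-IsPerm d xs↭ =
  ↭applyUpTo⇒IsPerm (↭-trans (↭.map⁺ (unrelabel d) xs↭) (↭-reflexive (map-unrelabel-relabel d _)))

-- A class of S_{N+1} with mask b is a class of S_K placed left of 1 (relabelled by the letters
-- selected by b) times a class of 1-squished permutations of S_{M+1} (relabelled by 1 and the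
-- remaining letters).
module Join (N : ℕ) (b : List Bool) (|b| : length b ≡ N) where

  K M : ℕ
  K = trues b
  M = trues (map not b)

  leftMask rightMask : List Bool
  leftMask  = false ∷ b
  rightMask = true ∷ map not b

  left right : ℕ → ℕ
  left  = relabel leftMask
  right = relabel rightMask

  join : Word → Word → Word
  join σ τ = map left σ ++ map right τ

  left-enumerates : map left (applyUpTo suc K) ≡ select b (letters≥2 N)
  left-enumerates = subst (λ n → map left (applyUpTo suc K) ≡ select b (applyUpTo (suc ∘ suc) n)) |b|
                          (map-relabel-applyUpTo leftMask)

  right-enumerates : map right (applyUpTo suc (suc M)) ≡ 1 ∷ select (map not b) (letters≥2 N)
  right-enumerates = subst (λ n → map right (applyUpTo suc (suc M)) ≡ 1 ∷ select (map not b) (applyUpTo (suc ∘ suc) n))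
                           (trans (length-map not b) |b|) (map-relabel-applyUpTo rightMask)

  left-perm : ∀ {σ} → IsPerm K σ → map left σ ↭ select b (letters≥2 N)
  left-perm σ∈S_K = ↭-trans (↭.map⁺ left (IsPerm⇒↭applyUpTo σ∈S_K)) (↭-reflexive left-enumerates)

  right-perm : ∀ {τ} → IsPerm (suc M) τ → map right τ ↭ 1 ∷ select (map not b) (letters≥2 N)
  right-perm τ∈S_M+1 = ↭-trans (↭.map⁺ right (IsPerm⇒↭applyUpTo τ∈S_M+1)) (↭-reflexive right-enumerates)

  left≥2 : ∀ {σ} → IsPerm K σ → All (2 ≤_) (map left σ)
  left≥2 σ∈S_K = ↭select-letters≥2⇒≥2 N b (left-perm σ∈S_K)

  join-SplitBy : ∀ {σ τ} → IsPerm K σ → Squished (suc M) τ → SplitBy N b (join σ τ)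
  join-SplitBy {σ} σ∈S_K (τ∈S_M+1 , sq) with Squished1⇒1∷ sq
  ... | τ₀ , refl = splitBy |b| (map left σ) (map right τ₀) refl (left-perm σ∈S_K) (drop-∷ (right-perm τ∈S_M+1))

  join-resp : ∀ {c σ σ′ τ τ′} → IsPerm K σ → IsPerm K σ′ → Squished (suc M) τ → Squished (suc M) τ′ →
              Equiv c K σ σ′ → Equiv c (suc M) τ τ′ → Equiv c (suc N) (join σ τ) (join σ′ τ′)
  join-resp {σ′ = σ′} {τ} σ∈S_K _ τ∈ _ σ~σ′ τ~τ′ = MoveEquiv⇒Equiv (SplitBy⇒IsPerm {N} {b} (join-SplitBy σ∈S_K τ∈))
    (MoveEquiv-++ʳ (map right τ) (MoveEquiv-relabel leftMask (Equiv⇒MoveEquiv σ~σ′)) ◅◅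
     MoveEquiv-++ˡ (map left σ′) (MoveEquiv-relabel rightMask (Equiv⇒MoveEquiv τ~τ′)))

  join-reflect : ∀ {c σ σ′ τ τ′} → IsPerm K σ → IsPerm K σ′ → Squished (suc M) τ → Squished (suc M) τ′ →
                 Equiv c (suc N) (join σ τ) (join σ′ τ′) → Equiv c K σ σ′ × Equiv c (suc M) τ τ′
  join-reflect {σ = σ} {σ′} σ∈S_K σ′∈S_K (τ∈S_M+1 , sq) (_ , sq′) e
    with Squished1⇒1∷ sq | Squished1⇒1∷ sq′
  ... | τ₀ , refl | τ₀′ , refl
    with MoveEquiv-split-at-1 (map left σ) (map right τ₀) (Equiv⇒MoveEquiv e) (left≥2 σ∈S_K)
           (≥2⇒≥1 (↭select-letters≥2⇒≥2 N (map not b) (drop-∷ (right-perm τ∈S_M+1))))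
  ...   | α′ , β′ , ≡join′ , left~α′ , right~β′
    with ++∷-injective α′ (map left σ′) (≥2⇒1∉ (All-resp-↭ (MoveEquiv⇒↭ left~α′) (left≥2 σ∈S_K)))
           (≥2⇒1∉ (left≥2 σ′∈S_K)) (sym ≡join′)
  ...     | refl , refl = MoveEquiv⇒Equiv σ∈S_K (MoveEquiv-relabel⁻ leftMask left~α′) ,
                          MoveEquiv⇒Equiv τ∈S_M+1 (MoveEquiv-relabel⁻ rightMask right~β′)

  join-onto : ∀ {c φ} → SplitBy N b φ → ∃₂ λ σ τ → IsPerm K σ × Squished (suc M) τ × Equiv c (suc N) φ (join σ τ)
  join-onto (splitBy _ α β refl α↭ β↭) =
    map (unrelabel leftMask) α , map (unrelabel rightMask) (1 ∷ β) ,
    ↭relabel⇒unrelabel-IsPerm leftMask α↭left , (↭relabel⇒unrelabel-IsPerm rightMask {n = suc M} 1β↭right , refl) ,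
    ≡⇒Equiv (sym (cong₂ _++_ (map-relabel-unrelabel leftMask {α} α-in-image)
                             (map-relabel-unrelabel rightMask {1 ∷ β} 1β-in-image)))
    where
    α↭left : α ↭ map left (applyUpTo suc K)
    α↭left = ↭-trans α↭ (↭-reflexive (sym left-enumerates))
    1β↭right : 1 ∷ β ↭ map right (applyUpTo suc (suc M))
    1β↭right = ↭-trans (↭-prep 1 β↭) (↭-reflexive (sym right-enumerates))
    α-in-image : All (InImage leftMask) α
    α-in-image = ↭relabel⇒InImage leftMask {ys = applyUpTo suc K} α↭left
    1β-in-image : All (InImage rightMask) (1 ∷ β)
    1β-in-image = ↭relabel⇒InImage rightMask {ys = applyUpTo suc (suc M)} 1β↭right

module _ {c : ℕ} {f g₁ : ℕ → ℕ} (isF : ∀ m → IsF c m (f m)) (isG₁ : ∀ m → IsG1 c m (g₁ m)) where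

  Sₙ-transversal : ∀ m → Transversal (IsPerm m) (Equiv c m) (f m)
  Sₙ-transversal m = Transversal-resp proj₁ (_, tt) (ClassesMeeting⇒Transversal (isF m))

  squished-transversal : ∀ m → Transversal (Squished m) (Equiv c m) (g₁ m)
  squished-transversal m = ClassesMeeting⇒Transversal (isG₁ m)

  f-zero : f 0 ≡ 1
  f-zero = Equiv-count-unique (Sₙ-transversal 0)
    (mkTransversal ([] ∷ []) refl (↭-refl ∷ []) ([] ∷ []) (λ ∅∈S₀ → here (≡⇒Equiv (↭-empty-inv ∅∈S₀))))

  -- For m < c there are no moves in S_{m+1}, and σ ↦ 1 (σ + 1) is a bijection from S_m onto
  -- the 1-squished permutations of S_{m+1}.
  g₁-suc≡f : ∀ {m} → suc m < suc c → g₁ (suc m) ≡ f m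
  g₁-suc≡f {m} m<c = Equiv-count-unique (squished-transversal (suc m))
    (Transversal-image prepend1 (EqClosure.transitive (MoveIn c (suc m))) prepend1-pres
      (λ _ _ σ~σ′ → ≡⇒Equiv (cong prepend1 (Equiv-trivial (<-trans (n<1+n m) m<c) σ~σ′)))
      (λ _ _ 1σ~1σ′ → ≡⇒Equiv (map-injective suc-injective (∷-injectiveʳ (Equiv-trivial m<c 1σ~1σ′))))
      prepend1-onto (Sₙ-transversal m))
    where
    prepend1 : Word → Word
    prepend1 σ = 1 ∷ map suc σ
    prepend1-pres : ∀ {σ} → IsPerm m σ → Squished (suc m) (prepend1 σ)
    prepend1-pres σ∈Sₘ = ↭applyUpTo⇒IsPerm (↭-prep 1 (↭-trans (↭.map⁺ suc (IsPerm⇒↭applyUpTo σ∈Sₘ))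
                                                              (↭-reflexive (map-applyUpTo suc suc m)))) , refl
    prepend1-onto : ∀ {τ} → Squished (suc m) τ → ∃ λ σ → IsPerm m σ × Equiv c (suc m) τ (prepend1 σ)
    prepend1-onto (τ∈Sₘ₊₁ , sq) with Squished1⇒1∷ sq
    ... | τ₀ , refl with ↭.↭-map-inv suc (↭-sym (drop-∷ (↭-trans (IsPerm⇒↭applyUpTo τ∈Sₘ₊₁)
                           (↭-reflexive (cong (1 ∷_) (sym (map-applyUpTo suc suc m)))))))
    ...   | σ , refl , σ↭ = σ , ↭applyUpTo⇒IsPerm (↭-sym σ↭) , ε

  SplitBy-transversal : ∀ N b → length b ≡ N →
    Transversal (SplitBy N b) (Equiv c (suc N)) (f (trues b) * g₁ (suc (trues (map not b))))
  SplitBy-transversal N b |b| = Transversal-× join (EqClosure.transitive (MoveIn c (suc N)))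
    join-SplitBy join-resp join-reflect join-onto (Sₙ-transversal K) (squished-transversal (suc M))
    where open Join N b |b|

  f-suc : ∀ N → f (suc N) ≡ binomialSum N (λ k → f k * g₁ (N ∸ k + 1))
  f-suc N = begin
    f (suc N)                                  ≡⟨ Equiv-count-unique (Sₙ-transversal (suc N)) all-classes ⟩
    sum (map classesWithMask (allMasks N))     ≡⟨ cong sum (map-cong-local
                                                    (All.map (λ {b} → classesWithMask≡ {b}) (allMasks-length N))) ⟩
    sum (map (F ∘ trues) (allMasks N))         ≡⟨ sum-allMasks N F ⟩
    binomialSum N F                            ∎
    where
    open ≡-Reasoning
    F : ℕ → ℕ
    F k = f k * g₁ (N ∸ k + 1)
    classesWithMask : List Bool → ℕ
    classesWithMask b = f (trues b) * g₁ (suc (trues (map not b)))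
    all-classes : Transversal (IsPerm (suc N)) (Equiv c (suc N)) (sum (map classesWithMask (allMasks N)))
    all-classes = Transversal-resp (λ split → SplitBy⇒IsPerm (proj₂ (Any.satisfied split))) IsPerm⇒SplitBy
      (Transversal-⋃ classesWithMask (allMasks N) (allMasks-distinct N) SplitBy-mask-invariant
                     (All.map (SplitBy-transversal N _) (allMasks-length N)))
    classesWithMask≡ : ∀ {b} → length b ≡ N → classesWithMask b ≡ F (trues b)
    classesWithMask≡ {b} |b| = cong (λ m → f (trues b) * g₁ m) (begin
      suc (trues (map not b))                    ≡⟨ +-comm 1 _ ⟩
      trues (map not b) + 1                      ≡⟨ cong (_+ 1) (m+n∸n≡m (trues (map not b)) (trues b)) ⟨
      trues (map not b) + trues b ∸ trues b + 1  ≡⟨ cong (λ n → n ∸ trues b + 1) (trans (trues-not b) |b|) ⟩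
      N ∸ trues b + 1                            ∎)

  f-large : ∀ n → suc c ≤ n →
    f n ≡ sum (map (λ j → f (j ∸ 1) * g₁ (n ∸ j + 1) * ((n ∸ 1) C (j ∸ 1))) (map suc (upTo n)))
  f-large (suc N) _ = trans (f-suc N)
    (cong sum (trans (map-cong (λ k → *-comm (N C k) _) (upTo (suc N))) (map-∘ (upTo (suc N)))))

  f-small : ∀ n → n < suc c → f n ≡ n !
  f-small = <-rec (λ n → n < suc c → f n ≡ n !) f-small-step
    where
    open ≡-Reasoning
    f-small-step : ∀ n → (∀ {m} → m < n → m < suc c → f m ≡ m !) → n < suc c → f n ≡ n !
    f-small-step zero    _   _   = f-zero
    f-small-step (suc N) rec N<c = begin
      f (suc N)                                  ≡⟨ f-suc N ⟩
      binomialSum N (λ k → f k * g₁ (N ∸ k + 1)) ≡⟨ cong sum (map-cong-local (All.applyUpTo⁺₁ id (suc N) term)) ⟩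
      binomialSum N (λ k → k ! * (N ∸ k) !)      ≡⟨ binomialSum-factorials N ⟩
      suc N !                                    ∎
      where
      term : ∀ {k} → k < suc N → (N C k) * (f k * g₁ (N ∸ k + 1)) ≡ (N C k) * (k ! * (N ∸ k) !)
      term {k} (s≤s k≤N) = cong ((N C k) *_) (cong₂ _*_ (rec (s≤s k≤N) (<-trans (s≤s k≤N) N<c)) (begin
        g₁ (N ∸ k + 1)   ≡⟨ cong g₁ (+-comm (N ∸ k) 1) ⟩
        g₁ (suc (N ∸ k)) ≡⟨ g₁-suc≡f N∸k<c ⟩
        f (N ∸ k)        ≡⟨ rec (s≤s (m∸n≤m N k)) (<-trans (n<1+n _) N∸k<c) ⟩
        (N ∸ k) !        ∎))
        where
        N∸k<c : suc (N ∸ k) < suc c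
        N∸k<c = ≤-<-trans (s≤s (m∸n≤m N k)) N<c

-- The argument works for every c.
mainTheorem13 : (c : ℕ) → 1 ≤ c → (f g1 : ℕ → ℕ) →
    (∀ m → IsF c m (f m)) → (∀ m → IsG1 c m (g1 m)) → (n : ℕ) →
    (n < suc c → f n ≡ n !) ×
    (suc c ≤ n → f n ≡ sum (map (λ j → f (j ∸ 1) * g1 (n ∸ j + 1) * ((n ∸ 1) C (j ∸ 1))) (map suc (upTo n))))
mainTheorem13 c _ f g1 isF isG₁ n = f-small isF isG₁ n , f-large isF isG₁ n
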